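{- Let $\mathbf{A}$ be an $n$-subtractive algebra ($n\ge 2$) with constant $0$. Then (a) for every compatible partial order $\le$ on $\mathbf{A}$ and every $a\in A\setminus\{0\}$, neither $0\le a$ nor $a\le 0$; and (b) for every compatible preorder $\le$ on $\mathbf{A}$ and every $a\in A\setminus\{0\}$, $0\le a$ if and only if $a\le 0$.
   Context: An algebra $\mathbf{A}$ is $n$-subtractive ($n\ge2$) if its type has a constant $0$ and there are binary terms $s_1(x,y),\dots,s_{n-1}(x,y)$ such that $\mathbf{A}$ satisfies $s_1(x,x)=0$, $s_i(x,0)=s_{i+1}(x,x)$ for $i=1,\dots,n-2$, and $s_{n-1}(x,0)=x$. A binary relation $\phi$ on $A$ is compatible if for every basic operation $f$ of arity $m$, $a_1\phi b_1,\dots,a_m\phi b_m$ imply $f(a_1,\dots,a_m)\,\phi\, f(b_1,\dots,b_m)$. -}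

module Defs where

open import Data.Nat using (ℕ; zero; suc; _∸_)
open import Data.Fin using (Fin; toℕ)
open import Data.Product using (Σ; _×_)
open import Relation.Binary.PropositionalEquality using (_≡_; refl)
open import Relation.Binary.Core using (Rel)
open import Level using (0ℓ)

record Algebra : Set₁ where
  field
    Op      : Set
    arity   : Op → ℕ
    Carrier : Set
    ⟦_⟧     : (f : Op) → (Fin (arity f) → Carrier) → Carrier

module _ (𝐀 : Algebra) where
  open Algebra 𝐀

  data Term (V : Set) : Set where
    var : V → Term V
    op  : (f : Op) → (Fin (arity f) → Term V) → Term V

  eval : {V : Set} → (V → Carrier) → Term V → Carrier
  eval ρ (var v)   = ρ v
  eval ρ (op f ts) = ⟦ f ⟧ (λ i → eval ρ (ts i))

  constVal : (c : Op) → arity c ≡ 0 → Carrier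
  constVal c eq = ⟦ c ⟧ (empty eq)
    where
      empty : ∀ {m} → m ≡ 0 → Fin m → Carrier
      empty refl ()

  ap₂ : Term (Fin 2) → Carrier → Carrier → Carrier
  ap₂ t x y = eval (λ { Fin.zero → x ; (Fin.suc Fin.zero) → y }) t

  -- 𝐀 is n-subtractive w.r.t. the constant 0 = o: binary terms
  -- s_1,…,s_{n-1}, indexed here by i : Fin (n ∸ 1) with s_{toℕ i + 1} = s i.
  IsNSubtractive : ℕ → (o : Carrier) → Set
  IsNSubtractive n o =
    Σ (Fin (n ∸ 1) → Term (Fin 2)) λ s →
      (∀ (i : Fin (n ∸ 1)) → toℕ i ≡ 0 → ∀ x → ap₂ (s i) x x ≡ o)
    × (∀ (i j : Fin (n ∸ 1)) → suc (toℕ i) ≡ toℕ j →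
          ∀ x → ap₂ (s i) x o ≡ ap₂ (s j) x x)
    × (∀ (i : Fin (n ∸ 1)) → suc (toℕ i) ≡ n ∸ 1 → ∀ x → ap₂ (s i) x o ≡ x)

  Compatible : Rel Carrier 0ℓ → Set
  Compatible R = ∀ (f : Op) (as bs : Fin (arity f) → Carrier) →
    (∀ i → R (as i) (bs i)) → R (⟦ f ⟧ as) (⟦ f ⟧ bs)

module Submission where

-- Let ≤ be a compatible preorder on an n-subtractive algebra
-- with terms s₁,…,s_{n-1}, and suppose 0 ≤ a.  Every term operation is
-- monotone for a compatible reflexive relation, so s_i(a,0) ≤ s_i(a,a).
-- By induction on i this gives s_i(a,0) ≤ 0 for every i: for i = 1 we have
-- s₁(a,a) = 0, and for i > 1 we have s_i(a,a) = s_{i-1}(a,0) ≤ 0.  At the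
-- last index s_{n-1}(a,0) = a, hence a ≤ 0.
--
-- The converse implication a ≤ 0 ⇒ 0 ≤ a is the same fact for the reverse
-- relation, which is again a compatible preorder; this is part (b).  Part (a)
-- follows from (b) and antisymmetry: either comparison of 0 with a forces
-- a = 0.

open import Defs
open import Data.Nat using (ℕ; _≤_; suc; s≤s)
open import Data.Fin using (Fin; toℕ; fromℕ; inject₁) renaming (zero to fzero; suc to fsuc)
open import Data.Fin.Properties using (toℕ-fromℕ; toℕ-inject₁)
open import Data.Fin.Induction using (<-weakInduction)
open import Data.Product using (_×_; _,_; proj₁; proj₂)
open import Function using (flip)
open import Relation.Nullary using (¬_)
open import Relation.Binary.PropositionalEquality using (_≡_; _≢_; refl; subst; cong)
open import Relation.Binary.Core using (Rel)
open import Relation.Binary.Structures using (IsPartialOrder; IsPreorder)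
import Relation.Binary.Construct.Flip.EqAndOrd as Flip
open import Level using (0ℓ)

module _ (𝐀 : Algebra) where
  open Algebra 𝐀

  eval-monotone : (R : Rel Carrier 0ℓ) → Compatible 𝐀 R →
    {V : Set} (ρ σ : V → Carrier) → (∀ v → R (ρ v) (σ v)) →
    (t : Term 𝐀 V) → R (eval 𝐀 ρ t) (eval 𝐀 σ t)
  eval-monotone R cmp ρ σ ρ≤σ (var v)   = ρ≤σ v
  eval-monotone R cmp ρ σ ρ≤σ (op f ts) =
    cmp f _ _ (λ i → eval-monotone R cmp ρ σ ρ≤σ (ts i))

  flip-compatible : (R : Rel Carrier 0ℓ) → Compatible 𝐀 R → Compatible 𝐀 (flip R)
  flip-compatible R cmp f as bs as≥bs = cmp f bs as as≥bs

  module _ (R : Rel Carrier 0ℓ) (pre : IsPreorder _≡_ R) (cmp : Compatible 𝐀 R) where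
    open IsPreorder pre using (trans) renaming (refl to ≤-refl)

    ap₂-monotoneʳ : (t : Term 𝐀 (Fin 2)) {x y y′ : Carrier} → R y y′ →
      R (ap₂ 𝐀 t x y) (ap₂ 𝐀 t x y′)
    ap₂-monotoneʳ t y≤y′ =
      eval-monotone R cmp _ _ (λ { fzero → ≤-refl ; (fsuc fzero) → y≤y′ }) t

    descent : (k : ℕ) (o : Carrier) (s : Fin (suc k) → Term 𝐀 (Fin 2)) →
      (∀ i → toℕ i ≡ 0 → ∀ x → ap₂ 𝐀 (s i) x x ≡ o) →
      (∀ i j → suc (toℕ i) ≡ toℕ j → ∀ x → ap₂ 𝐀 (s i) x o ≡ ap₂ 𝐀 (s j) x x) →
      (a : Carrier) → R o a → (i : Fin (suc k)) → R (ap₂ 𝐀 (s i) a o) o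
    descent k o s first next a o≤a = <-weakInduction P base step
      where
      P : Fin (suc k) → Set
      P i = R (ap₂ 𝐀 (s i) a o) o

      -- s₁(a,0) ≤ s₁(a,a) = 0
      base : P fzero
      base = subst (R _) (first fzero refl a) (ap₂-monotoneʳ (s fzero) o≤a)

      -- s_{i+1}(a,0) ≤ s_{i+1}(a,a) = s_i(a,0) ≤ 0
      step : ∀ i → P (inject₁ i) → P (fsuc i)
      step i ih = trans (ap₂-monotoneʳ (s (fsuc i)) o≤a)
        (subst (λ z → R z o) (next (inject₁ i) (fsuc i) (cong suc (toℕ-inject₁ i)) a) ih)

    above-zero⇒below-zero : (n : ℕ) → 2 ≤ n → (o : Carrier) → IsNSubtractive 𝐀 n o →
      (a : Carrier) → R o a → R a o
    above-zero⇒below-zero (suc (suc k)) (s≤s (s≤s _)) o (s , first , next , last) a o≤a =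
      subst (λ z → R z o) (last (fromℕ k) (cong suc (toℕ-fromℕ k)) a)
        (descent k o s first next a o≤a (fromℕ k))

  above⇔below-zero : (n : ℕ) → 2 ≤ n → (o : Carrier) → IsNSubtractive 𝐀 n o →
    (R : Rel Carrier 0ℓ) → IsPreorder _≡_ R → Compatible 𝐀 R →
    (a : Carrier) → (R o a → R a o) × (R a o → R o a)
  above⇔below-zero n 2≤n o sub R pre cmp a =
      above-zero⇒below-zero R pre cmp n 2≤n o sub a
    , above-zero⇒below-zero (flip R) (Flip.isPreorder pre) (flip-compatible R cmp) n 2≤n o sub a

  incomparable-with-zero : (n : ℕ) → 2 ≤ n → (o : Carrier) → IsNSubtractive 𝐀 n o →
    (R : Rel Carrier 0ℓ) → IsPartialOrder _≡_ R → Compatible 𝐀 R →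
    (a : Carrier) → a ≢ o → ¬ R o a × ¬ R a o
  incomparable-with-zero n 2≤n o sub R po cmp a a≢o =
      (λ o≤a → a≢o (antisym (up o≤a) o≤a))
    , (λ a≤o → a≢o (antisym a≤o (down a≤o)))
    where
    open IsPartialOrder po using (antisym; isPreorder)
    up-down : (R o a → R a o) × (R a o → R o a)
    up-down = above⇔below-zero n 2≤n o sub R isPreorder cmp a
    up : R o a → R a o
    up = proj₁ up-down
    down : R a o → R o a
    down = proj₂ up-down

proposition5p8 : (𝐀 : Algebra) (c : Algebra.Op 𝐀) (c0 : Algebra.arity 𝐀 c ≡ 0)
    (n : ℕ) → 2 ≤ n → IsNSubtractive 𝐀 n (constVal 𝐀 c c0) →
    ((R : Rel (Algebra.Carrier 𝐀) 0ℓ) → IsPartialOrder _≡_ R → Compatible 𝐀 R →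
      (a : Algebra.Carrier 𝐀) → a ≢ constVal 𝐀 c c0 →
      ¬ R (constVal 𝐀 c c0) a × ¬ R a (constVal 𝐀 c c0))
    × ((R : Rel (Algebra.Carrier 𝐀) 0ℓ) → IsPreorder _≡_ R → Compatible 𝐀 R →
      (a : Algebra.Carrier 𝐀) → a ≢ constVal 𝐀 c c0 →
      (R (constVal 𝐀 c c0) a → R a (constVal 𝐀 c c0))
      × (R a (constVal 𝐀 c c0) → R (constVal 𝐀 c c0) a))
proposition5p8 𝐀 c c0 n 2≤n sub =
    incomparable-with-zero 𝐀 n 2≤n (constVal 𝐀 c c0) sub
  , λ R pre cmp a _ → above⇔below-zero 𝐀 n 2≤n (constVal 𝐀 c c0) sub R pre cmp a
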